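{- Let $v$ be a word over $\{\mathsf N,\mathsf S\}$. The generating function of square lattice walks whose subword on $\{\mathsf N,\mathsf S\}$ is $v$, counted by the number of horizontal steps ($s$), the abscissa of the endpoint ($x$), and the number of $\mathsf{NW}$ plus $\mathsf{SE}$ factors ($a$), depends only on $|v|_{\mathsf N}$ and $|v|_{\mathsf S}$ and equals $$\mathcal A\,\mathcal B^{|v|_{\mathsf N}}\,\mathcal C^{|v|_{\mathsf S}},\qquad \mathcal A=\frac1{1-s(x+\bar x)},\quad \mathcal B=\frac{1+s\bar x(a-1)}{1-s(x+\bar x)},\quad \mathcal C=\frac{1+sx(a-1)}{1-s(x+\bar x)}.$$ The same holds when $a$ instead counts the number of $\mathsf{NW}$ plus $\mathsf{ES}$ factors, of $\mathsf{WN}$ plus $\mathsf{ES}$ factors, or of $\mathsf{WN}$ plus $\mathsf{SE}$ factors.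
   Context: Square lattice walks are words over $\{\mathsf N,\mathsf S,\mathsf E,\mathsf W\}$, read as walks from $(0,0)$ with $\mathsf E=(1,0)$, $\mathsf N=(0,1)$, $\mathsf W=(-1,0)$, $\mathsf S=(0,-1)$. An $XY$ factor is an occurrence of letter $X$ immediately followed by letter $Y$. $|v|_{\mathsf N}$, $|v|_{\mathsf S}$ are the numbers of letters $\mathsf N$, $\mathsf S$ in $v$; $\bar x=1/x$. -}

module Defs where

open import Level using (Level)
open import Data.Nat as ℕ using (ℕ; zero; suc)
open import Data.Integer as ℤ using (ℤ; +_; -[1+_])
open import Data.Bool using (Bool; true; false; if_then_else_; _∧_)
open import Data.List using (List; []; _∷_; length; map; concatMap; foldr)
open import Algebra.Bundles using (CommutativeRing)

data Step : Set where
  N S E W : Step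

Word : Set
Word = List Step

allWords : ℕ → List Word
allWords zero    = [] ∷ []
allWords (suc m) = concatMap (λ w → (N ∷ w) ∷ (S ∷ w) ∷ (E ∷ w) ∷ (W ∷ w) ∷ []) (allWords m)

_==ₛ_ : Step → Step → Bool
N ==ₛ N = true
S ==ₛ S = true
E ==ₛ E = true
W ==ₛ W = true
_ ==ₛ _ = false

_==w_ : Word → Word → Bool
[]       ==w []       = true
(p ∷ u) ==w (q ∷ w) = (p ==ₛ q) ∧ (u ==w w)
_        ==w _        = false

isVert : Step → Bool
isVert N = true
isVert S = true
isVert _ = false

projNS : Word → Word
projNS []      = []
projNS (p ∷ w) = if isVert p then p ∷ projNS w else projNS w

countN countS : Word → ℕ
countN []      = zero
countN (p ∷ w) = if p ==ₛ N then suc (countN w) else countN w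
countS []      = zero
countS (p ∷ w) = if p ==ₛ S then suc (countS w) else countS w

horiz : Word → ℕ
horiz []      = zero
horiz (p ∷ w) = if isVert p then horiz w else suc (horiz w)

abscissa : Word → ℤ
abscissa []      = + 0
abscissa (E ∷ w) = + 1 ℤ.+ abscissa w
abscissa (W ∷ w) = ℤ.- (+ 1) ℤ.+ abscissa w
abscissa (_ ∷ w) = abscissa w

factors : Step → Step → Word → ℕ
factors X Y []            = zero
factors X Y (p ∷ [])      = zero
factors X Y (p ∷ q ∷ w)   =
  if (p ==ₛ X) ∧ (q ==ₛ Y) then suc (factors X Y (q ∷ w)) else factors X Y (q ∷ w)

data Variant : Set where
  NW+SE NW+ES WN+ES WN+SE : Variant

stat : Variant → Word → ℕ
stat NW+SE w = factors N W w ℕ.+ factors S E w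
stat NW+ES w = factors N W w ℕ.+ factors E S w
stat WN+ES w = factors W N w ℕ.+ factors E S w
stat WN+SE w = factors W N w ℕ.+ factors S E w

-- Formal power series in s over a commutative ring R, in which
-- x and x̄ are (intended) mutually inverse and a is arbitrary.

module WithRing {c ℓ : Level} (R : CommutativeRing c ℓ) (x x̄ a : CommutativeRing.Carrier R) where
  open CommutativeRing R hiding (zero)

  pow : Carrier → ℕ → Carrier
  pow r zero    = 1#
  pow r (suc n) = r * pow r n

  xpow : ℤ → Carrier
  xpow (+ n)      = pow x n
  xpow -[1+ n ]   = pow x̄ (suc n)

  -- power series in s: coefficient sequences
  Series : Set c
  Series = ℕ → Carrier

  -- Cauchy product: (f ⊛ g) n = Σ_{i+j=n} f i * g j
  convo : Series → Series → ℕ → ℕ → Carrier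
  convo f g zero    k = f zero * g k
  convo f g (suc i) k = f (suc i) * g k + convo f g i (suc k)

  _⊛_ : Series → Series → Series
  (f ⊛ g) n = convo f g n zero

  oneS : Series
  oneS zero    = 1#
  oneS (suc _) = 0#

  _^S_ : Series → ℕ → Series
  f ^S zero    = oneS
  f ^S suc n   = f ⊛ (f ^S n)

  onePlus : Carrier → Series
  onePlus c zero          = 1#
  onePlus c (suc zero)    = c
  onePlus c (suc (suc _)) = 0#

  -- 1/(1 - c s) = Σ_n c^n s^n  (the multiplicative inverse of 1 - c s)
  geom : Carrier → Series
  geom c n = pow c n

  𝒜 𝓑 𝒞 : Series
  𝒜 = geom (x + x̄)
  𝓑 = onePlus (x̄ * (a - 1#)) ⊛ geom (x + x̄)
  𝒞 = onePlus (x * (a - 1#)) ⊛ geom (x + x̄)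

  sumR : List Carrier → Carrier
  sumR = foldr _+_ 0#

  weight : Variant → Word → Carrier
  weight var w = xpow (abscissa w) * pow a (stat var w)

  GF : Variant → Word → Series
  GF var v n =
    sumR (map (λ w → if (projNS w ==w v) ∧ (horiz w ℕ.≡ᵇ n) then weight var w else 0#)
              (allWords (length v ℕ.+ n)))

  RHS : Word → Series
  RHS v = 𝒜 ⊛ ((𝓑 ^S countN v) ⊛ (𝒞 ^S countS v))

-- Both the walk generating function G and the right-hand side satisfy, for vertical q,
--   F(qv, h+1) = (x + x̄) F(qv, h) + F(v, h+1) + δ_q F(v, h),   F(qv, 0) = F(v, 0),
--   F([], h+1) = (x + x̄) F([], h),   F([], 0) = 1,
-- with δ_N = x̄(a - 1) and δ_S = x(a - 1), and this recurrence determines F on vertical words.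
-- For G it comes from splitting off the first step of a walk: a step t following r contributes
-- an extra factor a exactly when rt is a counted factor. In every variant no step both ends and
-- begins a counted factor, so these corrections do not interact, and N (resp. S) has exactly one
-- counted neighbour, W (resp. E), which produces δ_q. For the right-hand side the recurrence
-- follows from 𝒜 = 1/(1 - s(x + x̄)), 𝓑 = (1 + s δ_N) 𝒜 and 𝒞 = (1 + s δ_S) 𝒜.

module Submission where

open import Defs
open import Level using (Level)
open import Data.Nat using (ℕ)
open import Data.Bool using (true)
open import Data.List.Relation.Unary.All using (All)
open import Relation.Binary.PropositionalEquality using (_≡_)
open import Algebra.Bundles using (CommutativeRing)

open import Level using (_⊔_)
open import Data.Nat as ℕ using (zero; suc)
import Data.Nat.Properties as ℕ
open import Algebra.Properties.CommutativeSemigroup ℕ.+-commutativeSemigroup using (interchange)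
open import Data.Integer as ℤ using (+_; -[1+_])
open import Data.Bool as Bool using (Bool; false; if_then_else_; _∧_)
open import Data.Bool.Properties using (∧-zeroʳ)
open import Data.List using (List; []; _∷_; length; map; concatMap; _++_; take)
open import Data.List.Relation.Unary.All using ([]; _∷_)
open import Data.Maybe using (Maybe; just; nothing)
open import Data.Product using (_×_; _,_)
open import Data.Sum using (_⊎_; inj₁; inj₂)
import Relation.Binary.PropositionalEquality as ≡
open import Relation.Nullary.Decidable using (Dec; from-yes; map′; _×-dec_; _⊎-dec_; _→-dec_)

Vert : Word → Set
Vert = All (λ p → isVert p ≡ true)

bonus : Variant → Step → Step → ℕ
bonus var p q = stat var (p ∷ q ∷ [])

headBonus : Variant → Step → Word → ℕ
headBonus var p w = stat var (p ∷ take 1 w)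

factors-∷ : ∀ X Y p w → factors X Y (p ∷ w) ≡ factors X Y (p ∷ take 1 w) ℕ.+ factors X Y w
factors-∷ X Y p []      = ≡.refl
factors-∷ X Y p (q ∷ w) with (p ==ₛ X) ∧ (q ==ₛ Y)
... | true  = ≡.refl
... | false = ≡.refl

two-factors-∷ : ∀ X Y X′ Y′ p w →
  factors X Y (p ∷ w) ℕ.+ factors X′ Y′ (p ∷ w)
    ≡ (factors X Y (p ∷ take 1 w) ℕ.+ factors X′ Y′ (p ∷ take 1 w)) ℕ.+ (factors X Y w ℕ.+ factors X′ Y′ w)
two-factors-∷ X Y X′ Y′ p w =
  ≡.trans (≡.cong₂ ℕ._+_ (factors-∷ X Y p w) (factors-∷ X′ Y′ p w))
    (interchange (factors X Y (p ∷ take 1 w)) (factors X Y w) (factors X′ Y′ (p ∷ take 1 w)) (factors X′ Y′ w))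

stat-∷ : ∀ var p w → stat var (p ∷ w) ≡ headBonus var p w ℕ.+ stat var w
stat-∷ NW+SE = two-factors-∷ N W S E
stat-∷ NW+ES = two-factors-∷ N W E S
stat-∷ WN+ES = two-factors-∷ W N E S
stat-∷ WN+SE = two-factors-∷ W N S E

∀-Step? : {P : Step → Set} → (∀ s → Dec (P s)) → Dec (∀ s → P s)
∀-Step? P? = map′ (λ { (n , s , e , w) → λ { N → n ; S → s ; E → e ; W → w } })
                  (λ f → f N , f S , f E , f W)
                  (P? N ×-dec P? S ×-dec P? E ×-dec P? W)

∀-Variant? : {P : Variant → Set} → (∀ var → Dec (P var)) → Dec (∀ var → P var)
∀-Variant? P? = map′ (λ { (p , q , r , s) → λ { NW+SE → p ; NW+ES → q ; WN+ES → r ; WN+SE → s } })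
                     (λ f → f NW+SE , f NW+ES , f WN+ES , f WN+SE)
                     (P? NW+SE ×-dec P? NW+ES ×-dec P? WN+ES ×-dec P? WN+SE)

stat-[] : ∀ var → stat var [] ≡ 0
stat-[] = from-yes (∀-Variant? λ var → stat var [] ℕ.≟ 0)

stat-[-] : ∀ var p → stat var (p ∷ []) ≡ 0
stat-[-] = from-yes (∀-Variant? λ var → ∀-Step? λ p → stat var (p ∷ []) ℕ.≟ 0)

same-kind-free : ∀ var p q → isVert p ≡ isVert q → bonus var p q ≡ 0
same-kind-free = from-yes (∀-Variant? λ var → ∀-Step? λ p → ∀-Step? λ q →
  (isVert p Bool.≟ isVert q) →-dec (bonus var p q ℕ.≟ 0))

closes-or-opens-nothing : ∀ var t → (∀ r → bonus var r t ≡ 0) ⊎ (∀ u → bonus var t u ≡ 0)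
closes-or-opens-nothing = from-yes (∀-Variant? λ var → ∀-Step? λ t →
  (∀-Step? λ r → bonus var r t ℕ.≟ 0) ⊎-dec (∀-Step? λ u → bonus var t u ℕ.≟ 0))

north-partner : ∀ var → bonus var N E ℕ.+ bonus var E N ≡ 0 × bonus var N W ℕ.+ bonus var W N ≡ 1
north-partner = from-yes (∀-Variant? λ var →
  (bonus var N E ℕ.+ bonus var E N ℕ.≟ 0) ×-dec (bonus var N W ℕ.+ bonus var W N ℕ.≟ 1))

south-partner : ∀ var → bonus var S E ℕ.+ bonus var E S ≡ 1 × bonus var S W ℕ.+ bonus var W S ≡ 0
south-partner = from-yes (∀-Variant? λ var →
  (bonus var S E ℕ.+ bonus var E S ℕ.≟ 1) ×-dec (bonus var S W ℕ.+ bonus var W S ℕ.≟ 0))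

shapeAfter : Step → Word → ℕ → Maybe (Word × ℕ)
shapeAfter N (N ∷ v) h = just (v , h)
shapeAfter S (S ∷ v) h = just (v , h)
shapeAfter E v (suc h) = just (v , h)
shapeAfter W v (suc h) = just (v , h)
shapeAfter _ _ _       = nothing

module Recurrence {c ℓ : Level} (R : CommutativeRing c ℓ) (x x̄ a : CommutativeRing.Carrier R) where
  open CommutativeRing R hiding (zero)

  δ : Step → Carrier
  δ N = x̄ * (a - 1#)
  δ S = x * (a - 1#)
  δ _ = 0#

  record Solves (F : Word → ℕ → Carrier) : Set (c ⊔ ℓ) where
    field
      nil-zero  : F [] zero ≈ 1#
      nil-suc   : ∀ h → F [] (suc h) ≈ (x + x̄) * F [] h
      cons-zero : ∀ {q} v → isVert q ≡ true → F (q ∷ v) zero ≈ F v zero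
      cons-suc  : ∀ {q} v h → isVert q ≡ true →
                  F (q ∷ v) (suc h) ≈ (x + x̄) * F (q ∷ v) h + (F v (suc h) + δ q * F v h)

  open Solves

  unique : ∀ {F F′} → Solves F → Solves F′ → ∀ {v} → Vert v → ∀ h → F v h ≈ F′ v h
  unique sF sF′ [] zero = trans (nil-zero sF) (sym (nil-zero sF′))
  unique sF sF′ [] (suc h) =
    trans (nil-suc sF h) (trans (*-congˡ (unique sF sF′ [] h)) (sym (nil-suc sF′ h)))
  unique sF sF′ (q↕ ∷ v↕) zero =
    trans (cons-zero sF _ q↕) (trans (unique sF sF′ v↕ zero) (sym (cons-zero sF′ _ q↕)))
  unique sF sF′ (q↕ ∷ v↕) (suc h) =
    trans (cons-suc sF _ h q↕)
      (trans (+-cong (*-congˡ (unique sF sF′ (q↕ ∷ v↕) h))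
                     (+-cong (unique sF sF′ v↕ (suc h)) (*-congˡ (unique sF sF′ v↕ h))))
             (sym (cons-suc sF′ _ h q↕)))

module PowerSeries {c ℓ : Level} (R : CommutativeRing c ℓ) (x x̄ a : CommutativeRing.Carrier R) where
  open CommutativeRing R hiding (zero)
  open WithRing R x x̄ a
  open Recurrence R x x̄ a using (δ; Solves)
  open import Relation.Binary.Reasoning.Setoid setoid
  open import Algebra.Solver.Ring.NaturalCoefficients.Default commutativeSemiring
    using (solve; _:+_; _:*_; _:=_)

  infix 4 _≋_
  _≋_ : Series → Series → Set ℓ
  f ≋ g = ∀ n → f n ≈ g n

  tail : Series → Series
  tail f n = f (suc n)

  -- convo f g i k = Σ_{j ≤ i} f j * g (i - j + k)

  convo-cong : ∀ {f f′ g g′} → f ≋ f′ → g ≋ g′ → ∀ i k → convo f g i k ≈ convo f′ g′ i k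
  convo-cong f≋ g≋ zero    k = *-cong (f≋ zero) (g≋ k)
  convo-cong f≋ g≋ (suc i) k = +-cong (*-cong (f≋ (suc i)) (g≋ k)) (convo-cong f≋ g≋ i (suc k))

  ⊛-cong : ∀ {f f′ g g′} → f ≋ f′ → g ≋ g′ → f ⊛ g ≋ f′ ⊛ g′
  ⊛-cong f≋ g≋ n = convo-cong f≋ g≋ n zero

  convo-tailʳ : ∀ f g i k → convo f g i (suc k) ≈ convo f (tail g) i k
  convo-tailʳ f g zero    k = refl
  convo-tailʳ f g (suc i) k = +-congˡ (convo-tailʳ f g i (suc k))

  ⊛-sucʳ : ∀ f g n → (f ⊛ g) (suc n) ≈ f (suc n) * g zero + (f ⊛ tail g) n
  ⊛-sucʳ f g n = +-congˡ (convo-tailʳ f g n zero)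

  convo-tailˡ : ∀ f g i k → convo f g (suc i) k ≈ convo (tail f) g i k + f zero * g (suc (i ℕ.+ k))
  convo-tailˡ f g zero    k = refl
  convo-tailˡ f g (suc i) k = begin
    f (suc (suc i)) * g k + convo f g (suc i) (suc k)
      ≈⟨ +-congˡ (convo-tailˡ f g i (suc k)) ⟩
    f (suc (suc i)) * g k + (convo (tail f) g i (suc k) + f zero * g (suc (i ℕ.+ suc k)))
      ≈⟨ sym (+-assoc _ _ _) ⟩
    convo (tail f) g (suc i) k + f zero * g (suc (i ℕ.+ suc k))
      ≡⟨ ≡.cong (λ m → convo (tail f) g (suc i) k + f zero * g (suc m)) (ℕ.+-suc i k) ⟩
    convo (tail f) g (suc i) k + f zero * g (suc (suc i ℕ.+ k)) ∎

  ⊛-sucˡ : ∀ f g n → (f ⊛ g) (suc n) ≈ (tail f ⊛ g) n + f zero * g (suc n)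
  ⊛-sucˡ f g n = begin
    (f ⊛ g) (suc n)                                 ≈⟨ convo-tailˡ f g n zero ⟩
    (tail f ⊛ g) n + f zero * g (suc (n ℕ.+ zero))  ≡⟨ ≡.cong (λ m → (tail f ⊛ g) n + f zero * g (suc m)) (ℕ.+-identityʳ n) ⟩
    (tail f ⊛ g) n + f zero * g (suc n)             ∎

  convo-+ˡ : ∀ f f′ g i k → convo (λ m → f m + f′ m) g i k ≈ convo f g i k + convo f′ g i k
  convo-+ˡ f f′ g zero    k = distribʳ _ _ _
  convo-+ˡ f f′ g (suc i) k =
    trans (+-cong (distribʳ _ _ _) (convo-+ˡ f f′ g i (suc k)))
          (solve 4 (λ p q r s → (p :+ q) :+ (r :+ s) := (p :+ r) :+ (q :+ s)) refl _ _ _ _)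

  convo-*ˡ : ∀ u f g i k → convo (λ m → u * f m) g i k ≈ u * convo f g i k
  convo-*ˡ u f g zero    k = *-assoc _ _ _
  convo-*ˡ u f g (suc i) k =
    trans (+-cong (*-assoc _ _ _) (convo-*ˡ u f g i (suc k))) (sym (distribˡ _ _ _))

  convo-0ˡ : ∀ g i k → convo (λ _ → 0#) g i k ≈ 0#
  convo-0ˡ g zero    k = zeroˡ _
  convo-0ˡ g (suc i) k = trans (+-cong (zeroˡ _) (convo-0ˡ g i (suc k))) (+-identityˡ _)

  ⊛-comm : ∀ f g → f ⊛ g ≋ g ⊛ f
  ⊛-comm f g zero    = *-comm _ _
  ⊛-comm f g (suc n) = begin
    (f ⊛ g) (suc n)                       ≈⟨ ⊛-sucˡ f g n ⟩
    (tail f ⊛ g) n + f zero * g (suc n)   ≈⟨ +-cong (⊛-comm (tail f) g n) (*-comm _ _) ⟩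
    (g ⊛ tail f) n + g (suc n) * f zero   ≈⟨ +-comm _ _ ⟩
    g (suc n) * f zero + (g ⊛ tail f) n   ≈⟨ ⊛-sucʳ g f n ⟨
    (g ⊛ f) (suc n)                       ∎

  ⊛-assoc : ∀ f g h → f ⊛ (g ⊛ h) ≋ (f ⊛ g) ⊛ h
  ⊛-assoc f g h zero    = sym (*-assoc _ _ _)
  ⊛-assoc f g h (suc n) = begin
    (f ⊛ (g ⊛ h)) (suc n)
      ≈⟨ ⊛-sucˡ f (g ⊛ h) n ⟩
    (tail f ⊛ (g ⊛ h)) n + f zero * (g ⊛ h) (suc n)
      ≈⟨ +-cong (⊛-assoc (tail f) g h n) (*-congˡ (⊛-sucˡ g h n)) ⟩
    ((tail f ⊛ g) ⊛ h) n + f zero * ((tail g ⊛ h) n + g zero * h (suc n))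
      ≈⟨ solve 5 (λ A u B v H → A :+ u :* (B :+ v :* H) := (A :+ u :* B) :+ (u :* v) :* H)
               refl _ _ _ _ _ ⟩
    (((tail f ⊛ g) ⊛ h) n + f zero * (tail g ⊛ h) n) + (f ⊛ g) zero * h (suc n)
      ≈⟨ +-congʳ tail-f⊛g ⟨
    (tail (f ⊛ g) ⊛ h) n + (f ⊛ g) zero * h (suc n)
      ≈⟨ ⊛-sucˡ (f ⊛ g) h n ⟨
    ((f ⊛ g) ⊛ h) (suc n) ∎
    where
    tail-f⊛g : (tail (f ⊛ g) ⊛ h) n ≈ ((tail f ⊛ g) ⊛ h) n + f zero * (tail g ⊛ h) n
    tail-f⊛g = begin
      (tail (f ⊛ g) ⊛ h) n
        ≈⟨ ⊛-cong (⊛-sucˡ f g) (λ _ → refl) n ⟩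
      convo (λ m → (tail f ⊛ g) m + f zero * g (suc m)) h n zero
        ≈⟨ convo-+ˡ (tail f ⊛ g) (λ m → f zero * tail g m) h n zero ⟩
      ((tail f ⊛ g) ⊛ h) n + convo (λ m → f zero * tail g m) h n zero
        ≈⟨ +-congˡ (convo-*ˡ (f zero) (tail g) h n zero) ⟩
      ((tail f ⊛ g) ⊛ h) n + f zero * (tail g ⊛ h) n ∎

  ⊛-identityˡ : ∀ f → oneS ⊛ f ≋ f
  ⊛-identityˡ f zero    = *-identityˡ _
  ⊛-identityˡ f (suc n) = begin
    (oneS ⊛ f) (suc n)                  ≈⟨ ⊛-sucˡ oneS f n ⟩
    (tail oneS ⊛ f) n + 1# * f (suc n)  ≈⟨ +-cong (convo-0ˡ f n zero) (*-identityˡ _) ⟩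
    0# + f (suc n)                      ≈⟨ +-identityˡ _ ⟩
    f (suc n)                           ∎

  ⊛-identityʳ : ∀ f → f ⊛ oneS ≋ f
  ⊛-identityʳ f n = trans (⊛-comm f oneS n) (⊛-identityˡ f n)

  ⊛-swap : ∀ f g h → f ⊛ (g ⊛ h) ≋ g ⊛ (f ⊛ h)
  ⊛-swap f g h n = begin
    (f ⊛ (g ⊛ h)) n  ≈⟨ ⊛-assoc f g h n ⟩
    ((f ⊛ g) ⊛ h) n  ≈⟨ ⊛-cong (⊛-comm f g) (λ _ → refl) n ⟩
    ((g ⊛ f) ⊛ h) n  ≈⟨ ⊛-assoc g f h n ⟨
    (g ⊛ (f ⊛ h)) n  ∎

  geom-⊛-suc : ∀ u f n → (geom u ⊛ f) (suc n) ≈ u * (geom u ⊛ f) n + f (suc n)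
  geom-⊛-suc u f n =
    trans (⊛-sucˡ (geom u) f n) (+-cong (convo-*ˡ u (geom u) f n zero) (*-identityˡ _))

  onePlus-⊛-suc : ∀ u f n → (onePlus u ⊛ f) (suc n) ≈ f (suc n) + u * f n
  onePlus-⊛-suc u f n = begin
    (onePlus u ⊛ f) (suc n)                        ≈⟨ ⊛-sucˡ (onePlus u) f n ⟩
    (tail (onePlus u) ⊛ f) n + 1# * f (suc n)      ≈⟨ +-cong tail-onePlus (*-identityˡ _) ⟩
    u * f n + f (suc n)                            ≈⟨ +-comm _ _ ⟩
    f (suc n) + u * f n                            ∎
    where
    tail-onePlus≋ : tail (onePlus u) ≋ (λ m → u * oneS m)
    tail-onePlus≋ zero    = sym (*-identityʳ u)
    tail-onePlus≋ (suc m) = sym (zeroʳ u)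
    tail-onePlus : (tail (onePlus u) ⊛ f) n ≈ u * f n
    tail-onePlus = begin
      (tail (onePlus u) ⊛ f) n          ≈⟨ ⊛-cong tail-onePlus≋ (λ _ → refl) n ⟩
      convo (λ m → u * oneS m) f n zero  ≈⟨ convo-*ˡ u oneS f n zero ⟩
      u * (oneS ⊛ f) n                   ≈⟨ *-congˡ (⊛-identityˡ f n) ⟩
      u * f n                            ∎

  RHS-[] : RHS [] ≋ 𝒜
  RHS-[] n = trans (⊛-cong (λ _ → refl) (⊛-identityˡ oneS) n) (⊛-identityʳ 𝒜 n)

  RHS-∷ : ∀ {q} v → isVert q ≡ true → RHS (q ∷ v) ≋ 𝒜 ⊛ (onePlus (δ q) ⊛ RHS v)
  RHS-∷ {N} v _ n = begin
    (𝒜 ⊛ ((𝓑 ⊛ Bᵏ) ⊛ Cˡ)) n                 ≈⟨ ⊛-cong (λ _ → refl) (⊛-assoc 𝓑 Bᵏ Cˡ) n ⟨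
    (𝒜 ⊛ ((onePlus (δ N) ⊛ 𝒜) ⊛ (Bᵏ ⊛ Cˡ))) n ≈⟨ ⊛-cong (λ _ → refl) (⊛-assoc (onePlus (δ N)) 𝒜 (Bᵏ ⊛ Cˡ)) n ⟨
    (𝒜 ⊛ (onePlus (δ N) ⊛ RHS v)) n         ∎
    where
    Bᵏ = 𝓑 ^S countN v
    Cˡ = 𝒞 ^S countS v
  RHS-∷ {S} v _ n = begin
    (𝒜 ⊛ (Bᵏ ⊛ (𝒞 ⊛ Cˡ))) n                 ≈⟨ ⊛-cong (λ _ → refl) (⊛-swap Bᵏ 𝒞 Cˡ) n ⟩
    (𝒜 ⊛ ((onePlus (δ S) ⊛ 𝒜) ⊛ (Bᵏ ⊛ Cˡ))) n ≈⟨ ⊛-cong (λ _ → refl) (⊛-assoc (onePlus (δ S)) 𝒜 (Bᵏ ⊛ Cˡ)) n ⟨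
    (𝒜 ⊛ (onePlus (δ S) ⊛ RHS v)) n         ∎
    where
    Bᵏ = 𝓑 ^S countN v
    Cˡ = 𝒞 ^S countS v

  RHS-solves : Solves RHS
  RHS-solves = record
    { nil-zero  = RHS-[] zero
    ; nil-suc   = λ h → trans (RHS-[] (suc h)) (*-congˡ (sym (RHS-[] h)))
    ; cons-zero = λ {q} v q↕ → begin
        RHS (q ∷ v) zero                            ≈⟨ RHS-∷ v q↕ zero ⟩
        1# * (onePlus (δ q) ⊛ RHS v) zero           ≈⟨ *-identityˡ _ ⟩
        1# * RHS v zero                             ≈⟨ *-identityˡ _ ⟩
        RHS v zero                                  ∎
    ; cons-suc  = λ {q} v h q↕ → begin
        RHS (q ∷ v) (suc h)
          ≈⟨ RHS-∷ v q↕ (suc h) ⟩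
        (𝒜 ⊛ (onePlus (δ q) ⊛ RHS v)) (suc h)
          ≈⟨ geom-⊛-suc (x + x̄) (onePlus (δ q) ⊛ RHS v) h ⟩
        (x + x̄) * (𝒜 ⊛ (onePlus (δ q) ⊛ RHS v)) h + (onePlus (δ q) ⊛ RHS v) (suc h)
          ≈⟨ +-cong (*-congˡ (sym (RHS-∷ v q↕ h))) (onePlus-⊛-suc (δ q) (RHS v) h) ⟩
        (x + x̄) * RHS (q ∷ v) h + (RHS v (suc h) + δ q * RHS v h) ∎
    }

module Enumeration {c ℓ : Level} (R : CommutativeRing c ℓ) (x x̄ a : CommutativeRing.Carrier R) where
  open CommutativeRing R hiding (zero)
  open WithRing R x x̄ a
  open import Data.List.Properties using (map-++)
  open import Relation.Binary.Reasoning.Setoid setoid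
  open import Algebra.Solver.Ring.NaturalCoefficients.Default commutativeSemiring
    using (solve; _:+_; _:=_)

  sumR-cong : ∀ {A : Set} {f g : A → Carrier} xs → (∀ y → f y ≈ g y) → sumR (map f xs) ≈ sumR (map g xs)
  sumR-cong []       f≈g = refl
  sumR-cong (y ∷ xs) f≈g = +-cong (f≈g y) (sumR-cong xs f≈g)

  sumR-0 : ∀ {A : Set} (xs : List A) → sumR (map (λ _ → 0#) xs) ≈ 0#
  sumR-0 []       = refl
  sumR-0 (_ ∷ xs) = trans (+-identityˡ _) (sumR-0 xs)

  sumR-* : ∀ {A : Set} k (f : A → Carrier) xs → sumR (map (λ y → k * f y) xs) ≈ k * sumR (map f xs)
  sumR-* k f []       = sym (zeroʳ k)
  sumR-* k f (y ∷ xs) = trans (+-congˡ (sumR-* k f xs)) (sym (distribˡ _ _ _))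

  sumR-++ : ∀ xs ys → sumR (xs ++ ys) ≈ sumR xs + sumR ys
  sumR-++ []       ys = sym (+-identityˡ _)
  sumR-++ (y ∷ xs) ys = trans (+-congˡ (sumR-++ xs ys)) (sym (+-assoc _ _ _))

  sumR-concatMap : ∀ {A B : Set} (f : B → Carrier) (g : A → List B) xs →
    sumR (map f (concatMap g xs)) ≈ sumR (map (λ y → sumR (map f (g y))) xs)
  sumR-concatMap f g []       = refl
  sumR-concatMap f g (y ∷ xs) = begin
    sumR (map f (g y ++ concatMap g xs))                 ≡⟨ ≡.cong sumR (map-++ f (g y) (concatMap g xs)) ⟩
    sumR (map f (g y) ++ map f (concatMap g xs))         ≈⟨ sumR-++ (map f (g y)) _ ⟩
    sumR (map f (g y)) + sumR (map f (concatMap g xs))   ≈⟨ +-congˡ (sumR-concatMap f g xs) ⟩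
    sumR (map (λ z → sumR (map f (g z))) (y ∷ xs))       ∎

  Σ-steps : (Step → Carrier) → Carrier
  Σ-steps f = f N + (f S + (f E + f W))

  Σ-steps-cong : ∀ {f g} → (∀ t → f t ≈ g t) → Σ-steps f ≈ Σ-steps g
  Σ-steps-cong f≈g = +-cong (f≈g N) (+-cong (f≈g S) (+-cong (f≈g E) (f≈g W)))

  Σ-steps-+ : ∀ f g → Σ-steps (λ t → f t + g t) ≈ Σ-steps f + Σ-steps g
  Σ-steps-+ f g = solve 8 (λ n s e w n′ s′ e′ w′ →
      (n :+ n′) :+ ((s :+ s′) :+ ((e :+ e′) :+ (w :+ w′)))
    := (n :+ (s :+ (e :+ w))) :+ (n′ :+ (s′ :+ (e′ :+ w′))))
    refl (f N) (f S) (f E) (f W) (g N) (g S) (g E) (g W)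

  Σ-steps-horizontal : ∀ f → f N ≈ 0# → f S ≈ 0# → Σ-steps f ≈ f E + f W
  Σ-steps-horizontal f fN≈0 fS≈0 =
    trans (+-cong fN≈0 (+-congʳ fS≈0)) (trans (+-identityˡ _) (+-identityˡ _))

  Σ-steps-halves : ∀ f → Σ-steps f ≈ (f N + f S) + (f E + f W)
  Σ-steps-halves f = sym (+-assoc _ _ _)

  Σ-steps-vertical : ∀ f → f E ≈ 0# → f W ≈ 0# → Σ-steps f ≈ f N + f S
  Σ-steps-vertical f fE≈0 fW≈0 =
    trans (Σ-steps-halves f) (trans (+-congˡ (trans (+-cong fE≈0 fW≈0) (+-identityʳ 0#))) (+-identityʳ _))

  sumR-Σ-steps : ∀ {A : Set} (F : Step → A → Carrier) xs →
    sumR (map (λ y → Σ-steps (λ t → F t y)) xs) ≈ Σ-steps (λ t → sumR (map (F t) xs))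
  sumR-Σ-steps F []       = sym (trans (+-identityˡ _) (trans (+-identityˡ _) (+-identityˡ _)))
  sumR-Σ-steps F (y ∷ xs) =
    trans (+-congˡ (sumR-Σ-steps F xs)) (sym (Σ-steps-+ (λ t → F t y) (λ t → sumR (map (F t) xs))))

  sumR-allWords-suc : ∀ (F : Word → Carrier) m →
    sumR (map F (allWords (suc m))) ≈ Σ-steps (λ t → sumR (map (λ w → F (t ∷ w)) (allWords m)))
  sumR-allWords-suc F m = begin
    sumR (map F (allWords (suc m)))
      ≈⟨ sumR-concatMap F _ (allWords m) ⟩
    sumR (map (λ w → F (N ∷ w) + (F (S ∷ w) + (F (E ∷ w) + (F (W ∷ w) + 0#)))) (allWords m))
      ≈⟨ sumR-cong (allWords m) (λ w → +-congˡ (+-congˡ (+-congˡ (+-identityʳ _)))) ⟩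
    sumR (map (λ w → Σ-steps (λ t → F (t ∷ w))) (allWords m))
      ≈⟨ sumR-Σ-steps (λ t w → F (t ∷ w)) (allWords m) ⟩
    Σ-steps (λ t → sumR (map (λ w → F (t ∷ w)) (allWords m))) ∎

  sumR-allWords-≡ : ∀ {m m′} (F : Word → Carrier) → m ≡ m′ → sumR (map F (allWords m)) ≈ sumR (map F (allWords m′))
  sumR-allWords-≡ F ≡.refl = refl

  hasShape : Word → ℕ → Word → Bool
  hasShape v h w = (projNS w ==w v) ∧ (horiz w ℕ.≡ᵇ h)

  restrict : (Word → Carrier) → Word → ℕ → Word → Carrier
  restrict f v h w = if hasShape v h w then f w else 0#

  -- every walk w with hasShape v h w has length |v| + h
  walkSum : (Word → Carrier) → Word → ℕ → Carrier
  walkSum f v h = sumR (map (restrict f v h) (allWords (length v ℕ.+ h)))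

  walkSum-cong : ∀ {f g} v h → (∀ w → f w ≈ g w) → walkSum f v h ≈ walkSum g v h
  walkSum-cong {f} {g} v h f≈g = sumR-cong (allWords (length v ℕ.+ h)) restrict-cong
    where
    restrict-cong : ∀ w → restrict f v h w ≈ restrict g v h w
    restrict-cong w with hasShape v h w
    ... | true  = f≈g w
    ... | false = refl

  walkSum-* : ∀ k f v h → walkSum (λ w → k * f w) v h ≈ k * walkSum f v h
  walkSum-* k f v h =
    trans (sumR-cong (allWords (length v ℕ.+ h)) restrict-*) (sumR-* k (restrict f v h) (allWords (length v ℕ.+ h)))
    where
    restrict-* : ∀ w → restrict (λ w → k * f w) v h w ≈ k * restrict f v h w
    restrict-* w with hasShape v h w
    ... | true  = refl
    ... | false = sym (zeroʳ k)

  emptyWalk : (Word → Carrier) → Word → ℕ → Carrier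
  emptyWalk f [] zero = f []
  emptyWalk f _  _    = 0#

  atShape : (Word → ℕ → Carrier) → Maybe (Word × ℕ) → Carrier
  atShape F nothing        = 0#
  atShape F (just (v , h)) = F v h

  atShape-cong : ∀ {F F′} → (∀ v h → F v h ≈ F′ v h) → ∀ m → atShape F m ≈ atShape F′ m
  atShape-cong F≈F′ nothing        = refl
  atShape-cong F≈F′ (just (v , h)) = F≈F′ v h

  too-many-horizontal-steps : ∀ (g : Word → Carrier) v m →
    sumR (map (λ w → if (projNS w ==w v) ∧ false then g w else 0#) (allWords m)) ≈ 0#
  too-many-horizontal-steps g v m = begin
    sumR (map (λ w → if (projNS w ==w v) ∧ false then g w else 0#) (allWords m))
      ≈⟨ sumR-cong (allWords m) (λ w → reflexive (≡.cong (λ b → if b then g w else 0#) (∧-zeroʳ _))) ⟩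
    sumR (map (λ _ → 0#) (allWords m))
      ≈⟨ sumR-0 (allWords m) ⟩
    0# ∎

  horizontal-length : ∀ (v : Word) h m → length v ℕ.+ suc h ≡ suc m → m ≡ length v ℕ.+ h
  horizontal-length v h m len = ≡.sym (ℕ.suc-injective (≡.trans (≡.sym (ℕ.+-suc (length v) h)) len))

  walks-starting-with : ∀ f t v h m → length v ℕ.+ h ≡ suc m →
    sumR (map (λ w → restrict f v h (t ∷ w)) (allWords m))
      ≈ atShape (walkSum (λ w → f (t ∷ w))) (shapeAfter t v h)
  walks-starting-with f N []      h m _   = sumR-0 (allWords m)
  walks-starting-with f N (N ∷ v) h m len = sumR-allWords-≡ (restrict (λ w → f (N ∷ w)) v h) (≡.sym (ℕ.suc-injective len))
  walks-starting-with f N (S ∷ v) h m _   = sumR-0 (allWords m)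
  walks-starting-with f N (E ∷ v) h m _   = sumR-0 (allWords m)
  walks-starting-with f N (W ∷ v) h m _   = sumR-0 (allWords m)
  walks-starting-with f S []      h m _   = sumR-0 (allWords m)
  walks-starting-with f S (N ∷ v) h m _   = sumR-0 (allWords m)
  walks-starting-with f S (S ∷ v) h m len = sumR-allWords-≡ (restrict (λ w → f (S ∷ w)) v h) (≡.sym (ℕ.suc-injective len))
  walks-starting-with f S (E ∷ v) h m _   = sumR-0 (allWords m)
  walks-starting-with f S (W ∷ v) h m _   = sumR-0 (allWords m)
  walks-starting-with f E v zero    m _   = too-many-horizontal-steps (λ w → f (E ∷ w)) v m
  walks-starting-with f E v (suc h) m len = sumR-allWords-≡ (restrict (λ w → f (E ∷ w)) v h) (horizontal-length v h m len)
  walks-starting-with f W v zero    m _   = too-many-horizontal-steps (λ w → f (W ∷ w)) v m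
  walks-starting-with f W v (suc h) m len = sumR-allWords-≡ (restrict (λ w → f (W ∷ w)) v h) (horizontal-length v h m len)

  nonempty-walks-by-first-step : ∀ f v h m → length v ℕ.+ h ≡ suc m →
    sumR (map (restrict f v h) (allWords (suc m)))
      ≈ Σ-steps (λ t → atShape (walkSum (λ w → f (t ∷ w))) (shapeAfter t v h))
  nonempty-walks-by-first-step f v h m len =
    trans (sumR-allWords-suc (restrict f v h) m) (Σ-steps-cong (λ t → walks-starting-with f t v h m len))

  walkSum-first-step : ∀ f v h →
    walkSum f v h ≈ emptyWalk f v h + Σ-steps (λ t → atShape (walkSum (λ w → f (t ∷ w))) (shapeAfter t v h))
  walkSum-first-step f [] zero =
    +-congˡ (sym (trans (+-identityˡ _) (trans (+-identityˡ _) (+-identityˡ _))))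
  walkSum-first-step f [] (suc h) =
    trans (nonempty-walks-by-first-step f [] (suc h) h ≡.refl) (sym (+-identityˡ _))
  walkSum-first-step f (q ∷ v) h =
    trans (nonempty-walks-by-first-step f (q ∷ v) h (length v ℕ.+ h) ≡.refl) (sym (+-identityˡ _))

  vertical-shapes : ∀ (F : Step → Maybe (Word × ℕ) → Carrier) → (∀ t → F t nothing ≈ 0#) →
    ∀ {q} v h → isVert q ≡ true → F N (shapeAfter N (q ∷ v) h) + F S (shapeAfter S (q ∷ v) h) ≈ F q (just (v , h))
  vertical-shapes F F-nothing {N} v h _ = trans (+-congˡ (F-nothing S)) (+-identityʳ _)
  vertical-shapes F F-nothing {S} v h _ = trans (+-congʳ (F-nothing N)) (+-identityˡ _)

module Walks {c ℓ : Level} (R : CommutativeRing c ℓ) (x x̄ a : CommutativeRing.Carrier R)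
  (x*x̄≈1 : CommutativeRing._≈_ R (CommutativeRing._*_ R x x̄) (CommutativeRing.1# R)) (var : Variant) where
  open CommutativeRing R hiding (zero)
  open WithRing R x x̄ a
  open Enumeration R x x̄ a
  open Recurrence R x x̄ a using (δ; Solves)
  open import Algebra.Properties.Ring ring using (-1*x≈-x)
  open import Relation.Binary.Reasoning.Setoid setoid
  open import Algebra.Solver.Ring.NaturalCoefficients.Default commutativeSemiring
    using (solve; _:+_; _:*_; _:=_)

  x*[x̄*y]≈y : ∀ y → x * (x̄ * y) ≈ y
  x*[x̄*y]≈y y = trans (sym (*-assoc x x̄ y)) (trans (*-congʳ x*x̄≈1) (*-identityˡ y))

  x̄*[x*y]≈y : ∀ y → x̄ * (x * y) ≈ y
  x̄*[x*y]≈y y = trans (sym (*-assoc x̄ x y)) (trans (*-congʳ (trans (*-comm x̄ x) x*x̄≈1)) (*-identityˡ y))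

  xpow-1+ : ∀ z → xpow (+ 1 ℤ.+ z) ≈ x * xpow z
  xpow-1+ (+ n)          = refl
  xpow-1+ -[1+ zero ]    = sym (x*[x̄*y]≈y 1#)
  xpow-1+ -[1+ suc n ]   = sym (x*[x̄*y]≈y _)

  xpow-[-1]+ : ∀ z → xpow (ℤ.- (+ 1) ℤ.+ z) ≈ x̄ * xpow z
  xpow-[-1]+ (+ zero)  = refl
  xpow-[-1]+ (+ suc n) = sym (x̄*[x*y]≈y _)
  xpow-[-1]+ -[1+ n ]  = refl

  stepWeight : Step → Carrier
  stepWeight N = 1#
  stepWeight S = 1#
  stepWeight E = x
  stepWeight W = x̄

  stepWeight-vertical : ∀ {q} → isVert q ≡ true → ∀ y → stepWeight q * y ≈ y
  stepWeight-vertical {N} _ = *-identityˡ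
  stepWeight-vertical {S} _ = *-identityˡ

  xpow-abscissa-∷ : ∀ t w → xpow (abscissa (t ∷ w)) ≈ stepWeight t * xpow (abscissa w)
  xpow-abscissa-∷ N w = sym (*-identityˡ _)
  xpow-abscissa-∷ S w = sym (*-identityˡ _)
  xpow-abscissa-∷ E w = xpow-1+ (abscissa w)
  xpow-abscissa-∷ W w = xpow-[-1]+ (abscissa w)

  pow-+ : ∀ m n → pow a (m ℕ.+ n) ≈ pow a m * pow a n
  pow-+ zero    n = sym (*-identityˡ _)
  pow-+ (suc m) n = trans (*-congˡ (pow-+ m n)) (sym (*-assoc _ _ _))

  weightAfter : Step → Word → Carrier
  weightAfter r w = pow a (headBonus var r w) * weight var w

  weight-∷ : ∀ t w → weight var (t ∷ w) ≈ stepWeight t * weightAfter t w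
  weight-∷ t w = begin
    xpow (abscissa (t ∷ w)) * pow a (stat var (t ∷ w))
      ≈⟨ *-cong (xpow-abscissa-∷ t w)
                (trans (reflexive (≡.cong (pow a) (stat-∷ var t w))) (pow-+ (headBonus var t w) (stat var w))) ⟩
    (stepWeight t * xpow (abscissa w)) * (pow a (headBonus var t w) * pow a (stat var w))
      ≈⟨ solve 4 (λ s X B T → (s :* X) :* (B :* T) := s :* (B :* (X :* T))) refl _ _ _ _ ⟩
    stepWeight t * weightAfter t w ∎

  weight-[] : weight var [] ≈ 1#
  weight-[] = trans (*-identityˡ _) (reflexive (≡.cong (pow a) (stat-[] var)))

  weightAfter-[] : ∀ r → weightAfter r [] ≈ weight var []
  weightAfter-[] r = trans (*-congʳ (reflexive (≡.cong (pow a) (stat-[-] var r)))) (*-identityˡ _)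

  weightAfter-inert : ∀ {t} → (∀ u → bonus var t u ≡ 0) → ∀ w → weightAfter t w ≈ weight var w
  weightAfter-inert {t} inert []      = weightAfter-[] t
  weightAfter-inert {t} inert (u ∷ w) = trans (*-congʳ (reflexive (≡.cong (pow a) (inert u)))) (*-identityˡ _)

  boost : ℕ → Carrier
  boost b = pow a b - 1#

  boost-0 : boost 0 ≈ 0#
  boost-0 = -‿inverseʳ 1#

  boost-1 : boost 1 ≈ a - 1#
  boost-1 = +-congʳ (*-identityʳ a)

  boost-free : ∀ {b} → b ≡ 0 → ∀ y → boost b * y ≈ 0#
  boost-free ≡.refl y = trans (*-congʳ boost-0) (zeroˡ y)

  pow≈1+boost : ∀ b y → pow a b * y ≈ y + boost b * y
  pow≈1+boost b y = sym (begin
    y + (pow a b - 1#) * y         ≈⟨ +-congˡ (trans (distribʳ y (pow a b) (- 1#)) (+-congˡ (-1*x≈-x y))) ⟩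
    y + (pow a b * y - y)          ≈⟨ +-comm _ _ ⟩
    (pow a b * y - y) + y          ≈⟨ +-assoc _ _ _ ⟩
    pow a b * y + (- y + y)        ≈⟨ +-congˡ (-‿inverseˡ y) ⟩
    pow a b * y + 0#               ≈⟨ +-identityʳ _ ⟩
    pow a b * y                    ∎)

  boost-sum-0 : ∀ b c → b ℕ.+ c ≡ 0 → boost b + boost c ≈ 0#
  boost-sum-0 zero    _ ≡.refl = trans (+-congʳ boost-0) (trans (+-identityˡ _) boost-0)
  boost-sum-0 (suc _) _ ()

  boost-sum-1 : ∀ b c → b ℕ.+ c ≡ 1 → boost b + boost c ≈ a - 1#
  boost-sum-1 zero          _ ≡.refl = trans (+-congʳ boost-0) (trans (+-identityˡ _) boost-1)
  boost-sum-1 (suc zero)    _ ≡.refl = trans (+-congˡ boost-0) (trans (+-identityʳ _) boost-1)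
  boost-sum-1 (suc (suc _)) _ ()

  partner-coefficient : ∀ {q} → isVert q ≡ true →
    x * (boost (bonus var q E) + boost (bonus var E q)) + x̄ * (boost (bonus var q W) + boost (bonus var W q))
      ≈ δ q
  partner-coefficient {N} _ with north-partner var
  ... | (viaE , viaW) = trans (+-cong (*-congˡ (boost-sum-0 (bonus var N E) (bonus var E N) viaE))
                                      (*-congˡ (boost-sum-1 (bonus var N W) (bonus var W N) viaW)))
                              (trans (+-congʳ (zeroʳ x)) (+-identityˡ _))
  partner-coefficient {S} _ with south-partner var
  ... | (viaE , viaW) = trans (+-cong (*-congˡ (boost-sum-1 (bonus var S E) (bonus var E S) viaE))
                                      (*-congˡ (boost-sum-0 (bonus var S W) (bonus var W S) viaW)))
                              (trans (+-congˡ (zeroʳ x̄)) (+-identityʳ _))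

  G : Word → ℕ → Carrier
  G = walkSum (weight var)

  correctionTerm : Step → Word → ℕ → Step → Carrier
  correctionTerm r v h t = boost (bonus var r t) * (stepWeight t * atShape G (shapeAfter t v h))

  correction : Step → Word → ℕ → Carrier
  correction r v h = Σ-steps (correctionTerm r v h)

  walkSum-weight-∷ : ∀ t v h → walkSum (λ w → weight var (t ∷ w)) v h ≈ stepWeight t * walkSum (weightAfter t) v h
  walkSum-weight-∷ t v h = trans (walkSum-cong v h (weight-∷ t)) (walkSum-* (stepWeight t) (weightAfter t) v h)

  walkSum-weightAfter-∷ : ∀ r t v h →
    walkSum (λ w → weightAfter r (t ∷ w)) v h
      ≈ walkSum (λ w → weight var (t ∷ w)) v h + boost (bonus var r t) * (stepWeight t * G v h)
  walkSum-weightAfter-∷ r t v h with closes-or-opens-nothing var t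
  ... | inj₁ closes-nothing = begin
    walkSum (λ w → weightAfter r (t ∷ w)) v h
      ≈⟨ walkSum-cong v h (λ w → trans (*-congʳ (reflexive (≡.cong (pow a) (closes-nothing r)))) (*-identityˡ _)) ⟩
    walkSum (λ w → weight var (t ∷ w)) v h
      ≈⟨ +-identityʳ _ ⟨
    walkSum (λ w → weight var (t ∷ w)) v h + 0#
      ≈⟨ +-congˡ (boost-free (closes-nothing r) _) ⟨
    walkSum (λ w → weight var (t ∷ w)) v h + boost (bonus var r t) * (stepWeight t * G v h) ∎
  ... | inj₂ opens-nothing = begin
    walkSum (λ w → weightAfter r (t ∷ w)) v h
      ≈⟨ walkSum-cong v h (λ w → *-congˡ (weight-∷ t w)) ⟩
    walkSum (λ w → pow a (bonus var r t) * (stepWeight t * weightAfter t w)) v h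
      ≈⟨ walkSum-* (pow a (bonus var r t)) (λ w → stepWeight t * weightAfter t w) v h ⟩
    pow a (bonus var r t) * walkSum (λ w → stepWeight t * weightAfter t w) v h
      ≈⟨ *-congˡ (trans (walkSum-* (stepWeight t) (weightAfter t) v h) (*-congˡ after-inert)) ⟩
    pow a (bonus var r t) * (stepWeight t * G v h)
      ≈⟨ pow≈1+boost (bonus var r t) (stepWeight t * G v h) ⟩
    stepWeight t * G v h + boost (bonus var r t) * (stepWeight t * G v h)
      ≈⟨ +-congʳ (trans (walkSum-weight-∷ t v h) (*-congˡ after-inert)) ⟨
    walkSum (λ w → weight var (t ∷ w)) v h + boost (bonus var r t) * (stepWeight t * G v h) ∎
    where
    after-inert : walkSum (weightAfter t) v h ≈ G v h
    after-inert = walkSum-cong v h (weightAfter-inert opens-nothing)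

  walkSum-weightAfter : ∀ r v h → walkSum (weightAfter r) v h ≈ G v h + correction r v h
  walkSum-weightAfter r v h = begin
    walkSum (weightAfter r) v h
      ≈⟨ walkSum-first-step (weightAfter r) v h ⟩
    emptyWalk (weightAfter r) v h + Σ-steps (λ t → atShape (walkSum (λ w → weightAfter r (t ∷ w))) (shapeAfter t v h))
      ≈⟨ +-cong (emptyWalk-after v h) (Σ-steps-cong (λ t → atShape-split t (shapeAfter t v h))) ⟩
    emptyWalk (weight var) v h + Σ-steps (λ t → prefixed t + corrected t)
      ≈⟨ +-congˡ (Σ-steps-+ prefixed corrected) ⟩
    emptyWalk (weight var) v h + (Σ-steps prefixed + correction r v h)
      ≈⟨ +-assoc _ _ _ ⟨
    (emptyWalk (weight var) v h + Σ-steps prefixed) + correction r v h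
      ≈⟨ +-congʳ (walkSum-first-step (weight var) v h) ⟨
    G v h + correction r v h ∎
    where
    prefixed corrected : Step → Carrier
    prefixed t  = atShape (walkSum (λ w → weight var (t ∷ w))) (shapeAfter t v h)
    corrected t = boost (bonus var r t) * (stepWeight t * atShape G (shapeAfter t v h))
    emptyWalk-after : ∀ v h → emptyWalk (weightAfter r) v h ≈ emptyWalk (weight var) v h
    emptyWalk-after []      zero    = weightAfter-[] r
    emptyWalk-after []      (suc h) = refl
    emptyWalk-after (_ ∷ _) h       = refl
    atShape-split : ∀ t m →
      atShape (walkSum (λ w → weightAfter r (t ∷ w))) m
        ≈ atShape (walkSum (λ w → weight var (t ∷ w))) m + boost (bonus var r t) * (stepWeight t * atShape G m)
    atShape-split t nothing        = sym (trans (+-identityˡ _) (trans (*-congˡ (zeroʳ _)) (zeroʳ _)))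
    atShape-split t (just (v , h)) = walkSum-weightAfter-∷ r t v h

  startingWith : Step → Word → ℕ → Carrier
  startingWith t v h = stepWeight t * (G v h + correction t v h)

  G-first-step : ∀ v h →
    G v h ≈ emptyWalk (weight var) v h + Σ-steps (λ t → atShape (startingWith t) (shapeAfter t v h))
  G-first-step v h =
    trans (walkSum-first-step (weight var) v h)
          (+-congˡ (Σ-steps-cong (λ t → atShape-cong (startingWith≈ t) (shapeAfter t v h))))
    where
    startingWith≈ : ∀ t v′ h′ → walkSum (λ w → weight var (t ∷ w)) v′ h′ ≈ startingWith t v′ h′
    startingWith≈ t v′ h′ = trans (walkSum-weight-∷ t v′ h′) (*-congˡ (walkSum-weightAfter t v′ h′))

  G-∷ : ∀ {q} v h → isVert q ≡ true →
    G (q ∷ v) h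
      ≈ startingWith q v h
        + (atShape (startingWith E) (shapeAfter E (q ∷ v) h) + atShape (startingWith W) (shapeAfter W (q ∷ v) h))
  G-∷ {q} v h q↕ = begin
    G (q ∷ v) h                ≈⟨ G-first-step (q ∷ v) h ⟩
    0# + Σ-steps F             ≈⟨ +-identityˡ _ ⟩
    Σ-steps F                  ≈⟨ Σ-steps-halves F ⟩
    (F N + F S) + (F E + F W)  ≈⟨ +-congʳ (vertical-shapes (λ t → atShape (startingWith t)) (λ _ → refl) v h q↕) ⟩
    startingWith q v h + (F E + F W) ∎
    where
    F : Step → Carrier
    F t = atShape (startingWith t) (shapeAfter t (q ∷ v) h)

  k*[s*0]≈0 : ∀ k s → k * (s * 0#) ≈ 0#
  k*[s*0]≈0 k s = trans (*-congˡ (zeroʳ s)) (zeroʳ k)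

  correction-vertical : ∀ {r} → isVert r ≡ true → ∀ v h →
    correction r v h
      ≈ boost (bonus var r E) * (x * atShape G (shapeAfter E v h)) + boost (bonus var r W) * (x̄ * atShape G (shapeAfter W v h))
  correction-vertical {r} r↕ v h =
    Σ-steps-horizontal (correctionTerm r v h) (boost-free (same-kind-free var r N r↕) _) (boost-free (same-kind-free var r S r↕) _)

  correction-horizontal-[] : ∀ {r} → isVert r ≡ false → ∀ h → correction r [] h ≈ 0#
  correction-horizontal-[] {r} r↔ h = begin
    correction r [] h
      ≈⟨ Σ-steps-horizontal (correctionTerm r [] h) (k*[s*0]≈0 _ _) (k*[s*0]≈0 _ _) ⟩
    boost (bonus var r E) * (x * atShape G (shapeAfter E [] h)) + boost (bonus var r W) * (x̄ * atShape G (shapeAfter W [] h))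
      ≈⟨ +-cong (boost-free (same-kind-free var r E r↔) _) (boost-free (same-kind-free var r W r↔) _) ⟩
    0# + 0#
      ≈⟨ +-identityʳ 0# ⟩
    0# ∎

  correction-horizontal-∷ : ∀ {r q} → isVert r ≡ false → isVert q ≡ true → ∀ v h →
    correction r (q ∷ v) h ≈ boost (bonus var r q) * G v h
  correction-horizontal-∷ {r} {q} r↔ q↕ v h = begin
    correction r (q ∷ v) h
      ≈⟨ Σ-steps-vertical (correctionTerm r (q ∷ v) h) (boost-free (same-kind-free var r E r↔) _) (boost-free (same-kind-free var r W r↔) _) ⟩
    F N (shapeAfter N (q ∷ v) h) + F S (shapeAfter S (q ∷ v) h)
      ≈⟨ vertical-shapes F (λ t → k*[s*0]≈0 _ _) v h q↕ ⟩
    boost (bonus var r q) * (stepWeight q * G v h)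
      ≈⟨ *-congˡ (stepWeight-vertical q↕ _) ⟩
    boost (bonus var r q) * G v h ∎
    where
    F : Step → Maybe (Word × ℕ) → Carrier
    F t m = boost (bonus var r t) * (stepWeight t * atShape G m)

  G-nil-suc : ∀ h → G [] (suc h) ≈ (x + x̄) * G [] h
  G-nil-suc h = begin
    G [] (suc h)                               ≈⟨ G-first-step [] (suc h) ⟩
    0# + Σ-steps (λ t → atShape (startingWith t) (shapeAfter t [] (suc h)))
                                               ≈⟨ +-identityˡ _ ⟩
    Σ-steps (λ t → atShape (startingWith t) (shapeAfter t [] (suc h)))
                                               ≈⟨ Σ-steps-horizontal (λ t → atShape (startingWith t) (shapeAfter t [] (suc h))) refl refl ⟩
    startingWith E [] h + startingWith W [] h  ≈⟨ +-cong (*-congˡ (uncorrected ≡.refl)) (*-congˡ (uncorrected ≡.refl)) ⟩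
    x * G [] h + x̄ * G [] h                    ≈⟨ distribʳ _ _ _ ⟨
    (x + x̄) * G [] h                           ∎
    where
    uncorrected : ∀ {r} → isVert r ≡ false → G [] h + correction r [] h ≈ G [] h
    uncorrected r↔ = trans (+-congˡ (correction-horizontal-[] r↔ h)) (+-identityʳ _)

  G-cons-zero : ∀ {q} v → isVert q ≡ true → G (q ∷ v) zero ≈ G v zero
  G-cons-zero {q} v q↕ = begin
    G (q ∷ v) zero                     ≈⟨ G-∷ v zero q↕ ⟩
    startingWith q v zero + (0# + 0#)  ≈⟨ trans (+-congˡ (+-identityʳ 0#)) (+-identityʳ _) ⟩
    startingWith q v zero              ≈⟨ stepWeight-vertical q↕ _ ⟩
    G v zero + correction q v zero     ≈⟨ +-congˡ (correction-vertical q↕ v zero) ⟩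
    G v zero + (boost (bonus var q E) * (x * 0#) + boost (bonus var q W) * (x̄ * 0#))
                                       ≈⟨ +-congˡ (trans (+-cong (k*[s*0]≈0 _ _) (k*[s*0]≈0 _ _)) (+-identityʳ 0#)) ⟩
    G v zero + 0#                      ≈⟨ +-identityʳ _ ⟩
    G v zero                           ∎

  G-cons-suc : ∀ {q} v h → isVert q ≡ true →
    G (q ∷ v) (suc h) ≈ (x + x̄) * G (q ∷ v) h + (G v (suc h) + δ q * G v h)
  G-cons-suc {q} v h q↕ = begin
    G (q ∷ v) (suc h)
      ≈⟨ G-∷ v (suc h) q↕ ⟩
    startingWith q v (suc h) + (startingWith E (q ∷ v) h + startingWith W (q ∷ v) h)
      ≈⟨ +-cong (stepWeight-vertical q↕ _)
                (+-cong (*-congˡ (+-congˡ (correction-horizontal-∷ ≡.refl q↕ v h)))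
                        (*-congˡ (+-congˡ (correction-horizontal-∷ ≡.refl q↕ v h)))) ⟩
    (G v (suc h) + correction q v (suc h))
      + (x * (G (q ∷ v) h + boost (bonus var E q) * G v h) + x̄ * (G (q ∷ v) h + boost (bonus var W q) * G v h))
      ≈⟨ +-congʳ (+-congˡ (correction-vertical q↕ v (suc h))) ⟩
    (G v (suc h) + (boost (bonus var q E) * (x * G v h) + boost (bonus var q W) * (x̄ * G v h)))
      + (x * (G (q ∷ v) h + boost (bonus var E q) * G v h) + x̄ * (G (q ∷ v) h + boost (bonus var W q) * G v h))
      ≈⟨ solve 9 (λ X X̄ G₀ G₁ G₂ bqE bqW bEq bWq →
           (G₁ :+ (bqE :* (X :* G₂) :+ bqW :* (X̄ :* G₂))) :+ (X :* (G₀ :+ bEq :* G₂) :+ X̄ :* (G₀ :+ bWq :* G₂))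
           := (X :+ X̄) :* G₀ :+ (G₁ :+ (X :* (bqE :+ bEq) :+ X̄ :* (bqW :+ bWq)) :* G₂))
           refl x x̄ (G (q ∷ v) h) (G v (suc h)) (G v h)
           (boost (bonus var q E)) (boost (bonus var q W)) (boost (bonus var E q)) (boost (bonus var W q)) ⟩
    (x + x̄) * G (q ∷ v) h
      + (G v (suc h)
         + (x * (boost (bonus var q E) + boost (bonus var E q)) + x̄ * (boost (bonus var q W) + boost (bonus var W q)))
           * G v h)
      ≈⟨ +-congˡ (+-congˡ (*-congʳ (partner-coefficient q↕))) ⟩
    (x + x̄) * G (q ∷ v) h + (G v (suc h) + δ q * G v h) ∎

  G-solves : Solves G
  G-solves = record
    { nil-zero  = trans (+-identityʳ _) weight-[]
    ; nil-suc   = G-nil-suc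
    ; cons-zero = G-cons-zero
    ; cons-suc  = G-cons-suc
    }

proposition4p10 : ∀ {c ℓ : Level} (R : CommutativeRing c ℓ)
    (x x̄ a : CommutativeRing.Carrier R) →
    CommutativeRing._≈_ R (CommutativeRing._*_ R x x̄) (CommutativeRing.1# R) →
    (var : Variant) (v : Word) → All (λ p → isVert p ≡ true) v →
    (n : ℕ) →
    CommutativeRing._≈_ R (WithRing.GF R x x̄ a var v n) (WithRing.RHS R x x̄ a v n)
proposition4p10 R x x̄ a x*x̄≈1 var v v↕ n =
  Recurrence.unique R x x̄ a (Walks.G-solves R x x̄ a x*x̄≈1 var) (PowerSeries.RHS-solves R x x̄ a) v↕ n
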